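{- Let $D=(\mathcal P,\mathcal B)$ be an incidence structure of type $(v,b,k,r,\lambda)$. For any nonempty set $S\subseteq\mathcal P$, there are at least $\dfrac{r^2|S|}{r+(|S|-1)\lambda}$ blocks which contain a point of $S$. If $D$ is a design, equality holds if and only if $S$ is a maximal arc of order $1+\frac{|S|-1}{r}\lambda$.
   Context: An incidence structure is a pair $D=(\mathcal P,\mathcal B)$ where $\mathcal B$ is a collection of subsets (blocks) of $\mathcal P$. It is of type $(v,b,k,r,\lambda)$ if $|\mathcal P|=v$, $|\mathcal B|=b$, every block contains $k$ points, every point lies in $r$ blocks, and $\lambda\ge1$ is the maximum, over pairs of distinct points, of the number of blocks containing both. It is a design if any two distinct points lie in exactly $\lambda$ common blocks. A maximal arc of order $n$ is a nonempty set of points $S$ such that every block meets $S$ in either $0$ or $n$ points. -}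

module Defs where

open import Data.Nat using (ℕ; zero; suc; _+_; _*_; _∸_; _≤_)
open import Data.Fin using (Fin)
open import Data.Fin.Subset using (Subset; _∈_; _∩_; ∣_∣; Nonempty)
open import Data.Fin.Subset.Properties using (_∈?_; nonempty?)
open import Data.List using (List; length; filter; allFin)
open import Data.Product using (_×_; Σ; ∃; _,_)
open import Data.Sum using (_⊎_)
open import Relation.Nullary using (¬_)
open import Relation.Nullary.Decidable using (_×-dec_)
open import Relation.Binary.PropositionalEquality using (_≡_)

-- An incidence structure with point set Fin v and b blocks, given as an
-- indexed family of subsets (repeated blocks allowed).
Blocks : ℕ → ℕ → Set
Blocks v b = Fin b → Subset v

replication : ∀ {v b} → Blocks v b → Fin v → ℕ
replication {b = b} B x = length (filter (λ i → x ∈? B i) (allFin b))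

pairCount : ∀ {v b} → Blocks v b → Fin v → Fin v → ℕ
pairCount {b = b} B x y =
  length (filter (λ i → (x ∈? B i) ×-dec (y ∈? B i)) (allFin b))

meetCount : ∀ {v b} → Blocks v b → Subset v → ℕ
meetCount {b = b} B S = length (filter (λ i → nonempty? (B i ∩ S)) (allFin b))

record IsOfType {v b : ℕ} (B : Blocks v b) (k r lam : ℕ) : Set where
  field
    blockSize   : ∀ i → ∣ B i ∣ ≡ k
    pointRepl   : ∀ x → replication B x ≡ r
    lam-pos       : 1 ≤ lam
    lam-bound     : ∀ x y → ¬ (x ≡ y) → pairCount B x y ≤ lam
    lam-attained  : Σ (Fin v) λ x → Σ (Fin v) λ y → ¬ (x ≡ y) × pairCount B x y ≡ lam

IsDesign : ∀ {v b} → Blocks v b → ℕ → Set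
IsDesign {v} B lam = ∀ (x y : Fin v) → ¬ (x ≡ y) → pairCount B x y ≡ lam

IsMaximalArc : ∀ {v b} → Blocks v b → Subset v → ℕ → Set
IsMaximalArc {b = b} B S n =
  Nonempty S × (∀ (i : Fin b) → (∣ B i ∩ S ∣ ≡ 0) ⊎ (∣ B i ∩ S ∣ ≡ n))

-- Write X i = ∣ B i ∩ S ∣, s = ∣ S ∣ and a = r + (s - 1) λ. Counting incident pairs and triples
-- gives ∑ X i = r s and ∑ X i² = ∑ over x, y ∈ S of pairCount x y ≤ s a, with equality for a
-- design. Cauchy–Schwarz over the m blocks meeting S then yields r² s ≤ m a. Over ℕ it is run
-- through the identity
--   ∑ over X i > 0 of (r X i - a)² + 2 r a ∑ X i = r² ∑ X i² + m a²,
-- whose square sum (the defect) vanishes exactly when r X i = a on every block meeting S,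
-- that is, when S is a maximal arc of order a / r.
module Submission where

open import Defs
open import Level using (Level)
open import Data.Bool.Base using (if_then_else_)
open import Data.Fin.Base using (Fin; zero; suc; punchIn)
open import Data.Fin.Properties using (punchInᵢ≢i; ¬∀⟶∃¬)
open import Data.Fin.Subset using (Subset; _∈_; _∩_; ∣_∣; Nonempty; inside; outside)
open import Data.Fin.Subset.Properties
  using (_∈?_; nonempty?; Empty-unique; ∣⊥∣≡0; ∩⇔×; x∈p⇒∣p-x∣<∣p∣)
open import Data.List.Base using (length; filter; tabulate)
open import Data.Nat.Base
open import Data.Nat.Properties
open import Data.Nat.Tactic.RingSolver using (solve-∀)
open import Algebra.Properties.Semiring.Sum +-*-semiring
open import Data.Product using (Σ; ∃; _×_; _,_)
open import Data.Sum.Base using (_⊎_; inj₁; inj₂; [_,_]′)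
open import Data.Vec.Base using ([]; _∷_)
open import Function.Base using (_∘_; id)
open import Function.Bundles using (_⇔_; mk⇔; Equivalence)
open import Function.Construct.Composition using (_⇔-∘_)
open import Relation.Nullary using (Dec; yes; no; does; ¬_; contradiction)
open import Relation.Nullary.Decidable using (_×-dec_)
open import Relation.Unary using (Pred; Decidable)
open import Relation.Binary.PropositionalEquality

private variable
  ℓ ℓ′ ℓ″ : Level
  A : Set ℓ″
  P : Set ℓ
  Q : Set ℓ′
  n : ℕ

𝟙 : Dec P → ℕ
𝟙 P? = if does P? then 1 else 0

𝟙-yes : (P? : Dec P) → P → 𝟙 P? ≡ 1
𝟙-yes (yes _) _ = refl
𝟙-yes (no ¬p) p = contradiction p ¬p

𝟙-no : (P? : Dec P) → ¬ P → 𝟙 P? ≡ 0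
𝟙-no (yes p) ¬p = contradiction p ¬p
𝟙-no (no _)  _  = refl

𝟙-cong : P ⇔ Q → (P? : Dec P) (Q? : Dec Q) → 𝟙 P? ≡ 𝟙 Q?
𝟙-cong P⇔Q (yes p) Q? = sym (𝟙-yes Q? (Equivalence.to P⇔Q p))
𝟙-cong P⇔Q (no ¬p) Q? = sym (𝟙-no Q? (¬p ∘ Equivalence.from P⇔Q))

𝟙-×-dec : (P? : Dec P) (Q? : Dec Q) → 𝟙 (P? ×-dec Q?) ≡ 𝟙 P? * 𝟙 Q?
𝟙-×-dec (yes _) (yes _) = refl
𝟙-×-dec (yes _) (no _)  = refl
𝟙-×-dec (no _)  _       = refl

𝟙-idem : (P? : Dec P) → 𝟙 P? * 𝟙 P? ≡ 𝟙 P?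
𝟙-idem (yes _) = refl
𝟙-idem (no _)  = refl

𝟙≤1 : (P? : Dec P) → 𝟙 P? ≤ 1
𝟙≤1 (yes _) = ≤-refl
𝟙≤1 (no _)  = z≤n

𝟙-*-mono-≤ : ∀ {m n} (P? : Dec P) → (P → m ≤ n) → 𝟙 P? * m ≤ 𝟙 P? * n
𝟙-*-mono-≤ (yes p) m≤n = *-monoʳ-≤ 1 (m≤n p)
𝟙-*-mono-≤ (no _)  _   = z≤n

𝟙-*-cong : ∀ {m n} (P? : Dec P) → (P → m ≡ n) → 𝟙 P? * m ≡ 𝟙 P? * n
𝟙-*-cong (yes p) m≡n = cong (1 *_) (m≡n p)
𝟙-*-cong (no _)  _   = refl

length-filter-tabulate : ∀ {P : Pred A ℓ} (P? : Decidable P) (f : Fin n → A) →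
                         length (filter P? (tabulate f)) ≡ ∑[ i < n ] 𝟙 (P? (f i))
length-filter-tabulate {n = zero}  P? f = refl
length-filter-tabulate {n = suc n} P? f with P? (f zero)
... | yes _ = cong suc (length-filter-tabulate P? (f ∘ suc))
... | no  _ = length-filter-tabulate P? (f ∘ suc)

sum-mono-≤ : {f g : Fin n → ℕ} → (∀ i → f i ≤ g i) → sum f ≤ sum g
sum-mono-≤ {n = zero}  f≤g = z≤n
sum-mono-≤ {n = suc n} f≤g = +-mono-≤ (f≤g zero) (sum-mono-≤ (f≤g ∘ suc))

sum≡0⇒≡0 : (f : Fin n → ℕ) → sum f ≡ 0 → ∀ i → f i ≡ 0
sum≡0⇒≡0 {n = suc n} f Σf≡0 i = m+n≡0⇒m≡0 (f i) (trans (sym (sum-remove {i = i} f)) Σf≡0)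

sum≡0⇔ : (f : Fin n → ℕ) → sum f ≡ 0 ⇔ (∀ i → f i ≡ 0)
sum≡0⇔ {n} f = mk⇔ (sum≡0⇒≡0 f) (λ f≡0 → trans (sum-cong-≗ f≡0) (sum-replicate-zero n))

sum≢0⇒∃≢0 : (f : Fin n → ℕ) → sum f ≢ 0 → ∃ λ i → f i ≢ 0
sum≢0⇒∃≢0 {n} f Σf≢0 =
  ¬∀⟶∃¬ n (λ i → f i ≡ 0) (λ i → f i ≟ 0) (Σf≢0 ∘ Equivalence.from (sum≡0⇔ f))

sum-*-sum : ∀ {m} (f : Fin m → ℕ) (g : Fin n → ℕ) →
            sum f * sum g ≡ ∑[ i < m ] ∑[ j < n ] (f i * g j)
sum-*-sum f g = trans (*-distribʳ-sum (sum g) f) (sum-cong-≗ λ i → *-distribˡ-sum (f i) g)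

sum-remove-diagonal : (w f : Fin (suc n) → ℕ) {x : Fin (suc n)} {d : ℕ} → w x ≡ 1 → f x ≡ d →
                      ∑[ y < suc n ] (w y * f y) ≡ d + ∑[ j < n ] (w (punchIn x j) * f (punchIn x j))
sum-remove-diagonal w f {x} wx≡1 fx≡d = trans (sum-remove {i = x} (λ y → w y * f y))
  (cong (_+ sum (λ j → w (punchIn x j) * f (punchIn x j))) (trans (cong₂ _*_ wx≡1 fx≡d) (*-identityˡ _)))

sum-remove-weights : (w : Fin (suc n) → ℕ) {x : Fin (suc n)} (l : ℕ) → w x ≡ 1 →
                     ∑[ j < n ] (w (punchIn x j) * l) ≡ (sum w ∸ 1) * l
sum-remove-weights {n} w {x} l wx≡1 = begin
  ∑[ j < n ] (w (punchIn x j) * l)           ≡⟨ *-distribʳ-sum l (w ∘ punchIn x) ⟨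
  sum (w ∘ punchIn x) * l                    ≡⟨ cong (λ t → (t ∸ 1) * l) (cong (_+ sum (w ∘ punchIn x)) wx≡1) ⟨
  (w x + sum (w ∘ punchIn x) ∸ 1) * l        ≡⟨ cong (λ t → (t ∸ 1) * l) (sum-remove {i = x} w) ⟨
  (sum w ∸ 1) * l                            ∎
  where open ≡-Reasoning

sum-diagonal-≤ : (w f : Fin n → ℕ) {x : Fin n} {d l : ℕ} → w x ≡ 1 → f x ≡ d →
                 (∀ y → y ≢ x → f y ≤ l) → ∑[ y < n ] (w y * f y) ≤ d + (sum w ∸ 1) * l
sum-diagonal-≤ {n = suc n} w f {x} {d} {l} wx≡1 fx≡d off≤l = begin
  ∑[ y < suc n ] (w y * f y)                           ≡⟨ sum-remove-diagonal w f wx≡1 fx≡d ⟩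
  d + ∑[ j < n ] (w (punchIn x j) * f (punchIn x j))
    ≤⟨ +-monoʳ-≤ d (sum-mono-≤ λ j → *-monoʳ-≤ (w (punchIn x j)) (off≤l _ (punchInᵢ≢i x j))) ⟩
  d + ∑[ j < n ] (w (punchIn x j) * l)                 ≡⟨ cong (d +_) (sum-remove-weights w l wx≡1) ⟩
  d + (sum w ∸ 1) * l                                  ∎
  where open ≤-Reasoning

sum-diagonal-≡ : (w f : Fin n → ℕ) {x : Fin n} {d l : ℕ} → w x ≡ 1 → f x ≡ d →
                 (∀ y → y ≢ x → f y ≡ l) → ∑[ y < n ] (w y * f y) ≡ d + (sum w ∸ 1) * l
sum-diagonal-≡ {n = suc n} w f {x} {d} {l} wx≡1 fx≡d off≡l = begin
  ∑[ y < suc n ] (w y * f y)                           ≡⟨ sum-remove-diagonal w f wx≡1 fx≡d ⟩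
  d + ∑[ j < n ] (w (punchIn x j) * f (punchIn x j))
    ≡⟨ cong (d +_) (sum-cong-≗ λ j → cong (w (punchIn x j) *_) (off≡l _ (punchInᵢ≢i x j))) ⟩
  d + ∑[ j < n ] (w (punchIn x j) * l)                 ≡⟨ cong (d +_) (sum-remove-weights w l wx≡1) ⟩
  d + (sum w ∸ 1) * l                                  ∎
  where open ≡-Reasoning

χ : Subset n → Fin n → ℕ
χ p x = 𝟙 (x ∈? p)

∣p∣≡∑χ : (p : Subset n) → ∣ p ∣ ≡ sum (χ p)
∣p∣≡∑χ []            = refl
∣p∣≡∑χ (inside  ∷ p) = cong suc (∣p∣≡∑χ p)
∣p∣≡∑χ (outside ∷ p) = ∣p∣≡∑χ p

χ-∩ : (p q : Subset n) (x : Fin n) → χ (p ∩ q) x ≡ χ p x * χ q x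
χ-∩ p q x = trans (𝟙-cong ∩⇔× (x ∈? p ∩ q) ((x ∈? p) ×-dec (x ∈? q))) (𝟙-×-dec (x ∈? p) (x ∈? q))

∣p∩q∣≡∑χχ : (p q : Subset n) → ∣ p ∩ q ∣ ≡ ∑[ x < n ] (χ p x * χ q x)
∣p∩q∣≡∑χχ p q = trans (∣p∣≡∑χ (p ∩ q)) (sum-cong-≗ (χ-∩ p q))

Nonempty⇔0<∣p∣ : (p : Subset n) → Nonempty p ⇔ 0 < ∣ p ∣
Nonempty⇔0<∣p∣ {n} p = mk⇔ to from
  where
  to : Nonempty p → 0 < ∣ p ∣
  to (_ , x∈p) = ≤-trans (s≤s z≤n) (x∈p⇒∣p-x∣<∣p∣ x∈p)
  from : 0 < ∣ p ∣ → Nonempty p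
  from 0<∣p∣ with nonempty? p
  ... | yes ne = ne
  ... | no  ¬ne = contradiction (trans (cong ∣_∣ (Empty-unique ¬ne)) (∣⊥∣≡0 n)) (>⇒≢ 0<∣p∣)

m≤n⇒∣m-n∣²+2mn≡m²+n² : ∀ {m n} → m ≤ n → ∣ m - n ∣ * ∣ m - n ∣ + 2 * (m * n) ≡ m * m + n * n
m≤n⇒∣m-n∣²+2mn≡m²+n² {m} m≤n with o , refl ← m≤n⇒∃[o]m+o≡n m≤n
  rewrite ∣m-m+n∣≡n m o = identity m o
  where
  identity : ∀ m o → o * o + 2 * (m * (m + o)) ≡ m * m + (m + o) * (m + o)
  identity = solve-∀

∣m-n∣²+2mn≡m²+n² : ∀ m n → ∣ m - n ∣ * ∣ m - n ∣ + 2 * (m * n) ≡ m * m + n * n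
∣m-n∣²+2mn≡m²+n² m n with ≤-total m n
... | inj₁ m≤n = m≤n⇒∣m-n∣²+2mn≡m²+n² m≤n
... | inj₂ n≤m = begin
  ∣ m - n ∣ * ∣ m - n ∣ + 2 * (m * n) ≡⟨ cong₂ (λ d e → d * d + 2 * e) (∣-∣-comm m n) (*-comm m n) ⟩
  ∣ n - m ∣ * ∣ n - m ∣ + 2 * (n * m) ≡⟨ m≤n⇒∣m-n∣²+2mn≡m²+n² n≤m ⟩
  n * n + m * m                        ≡⟨ +-comm (n * n) (m * m) ⟩
  m * m + n * n                        ∎
  where open ≡-Reasoning

supportSize : (Fin n → ℕ) → ℕ
supportSize {n} X = ∑[ i < n ] 𝟙 (0 <? X i)

sumSq : (Fin n → ℕ) → ℕ
sumSq {n} X = ∑[ i < n ] (X i * X i)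

defectTerm : ℕ → ℕ → ℕ → ℕ
defectTerm c a x = 𝟙 (0 <? x) * (∣ c * x - a ∣ * ∣ c * x - a ∣)

defect : ℕ → ℕ → (Fin n → ℕ) → ℕ
defect {n} c a X = ∑[ i < n ] defectTerm c a (X i)

defectTerm-identity : ∀ c a x → defectTerm c a x + 2 * (c * a) * x ≡ c * c * (x * x) + 𝟙 (0 <? x) * (a * a)
defectTerm-identity c a zero = identity c a (∣ c * 0 - a ∣ * ∣ c * 0 - a ∣)
  where
  identity : ∀ c a d → 0 * d + 2 * (c * a) * 0 ≡ c * c * (0 * 0) + 0 * (a * a)
  identity = solve-∀
defectTerm-identity c a x@(suc _) = begin
  1 * (d * d) + 2 * (c * a) * x ≡⟨ identity₁ (d * d) c a x ⟩
  d * d + 2 * (c * x * a)       ≡⟨ ∣m-n∣²+2mn≡m²+n² (c * x) a ⟩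
  c * x * (c * x) + a * a       ≡⟨ identity₂ c a x ⟩
  c * c * (x * x) + 1 * (a * a) ∎
  where
  open ≡-Reasoning
  d : ℕ
  d = ∣ c * x - a ∣
  identity₁ : ∀ e c a x → 1 * e + 2 * (c * a) * x ≡ e + 2 * (c * x * a)
  identity₁ = solve-∀
  identity₂ : ∀ c a x → c * x * (c * x) + a * a ≡ c * c * (x * x) + 1 * (a * a)
  identity₂ = solve-∀

defect-identity : ∀ c a (X : Fin n → ℕ) →
                  defect c a X + 2 * (c * a) * sum X ≡ c * c * sumSq X + supportSize X * (a * a)
defect-identity {n} c a X = begin
  defect c a X + 2 * (c * a) * sum X
    ≡⟨ cong (defect c a X +_) (*-distribˡ-sum (2 * (c * a)) X) ⟩
  defect c a X + ∑[ i < n ] (2 * (c * a) * X i)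
    ≡⟨ ∑-distrib-+ (λ i → defectTerm c a (X i)) (λ i → 2 * (c * a) * X i) ⟨
  ∑[ i < n ] (defectTerm c a (X i) + 2 * (c * a) * X i)
    ≡⟨ sum-cong-≗ (λ i → defectTerm-identity c a (X i)) ⟩
  ∑[ i < n ] (c * c * (X i * X i) + 𝟙 (0 <? X i) * (a * a))
    ≡⟨ ∑-distrib-+ (λ i → c * c * (X i * X i)) (λ i → 𝟙 (0 <? X i) * (a * a)) ⟩
  ∑[ i < n ] (c * c * (X i * X i)) + ∑[ i < n ] (𝟙 (0 <? X i) * (a * a))
    ≡⟨ cong₂ _+_ (*-distribˡ-sum (c * c) (λ i → X i * X i)) (*-distribʳ-sum (a * a) (λ i → 𝟙 (0 <? X i))) ⟨
  c * c * sumSq X + supportSize X * (a * a) ∎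
  where open ≡-Reasoning

defectTerm≡0⇔ : ∀ c a x → defectTerm c a x ≡ 0 ⇔ (0 < x → c * x ≡ a)
defectTerm≡0⇔ c a x = mk⇔ to from
  where
  d : ℕ
  d = ∣ c * x - a ∣
  to : 𝟙 (0 <? x) * (d * d) ≡ 0 → 0 < x → c * x ≡ a
  to term≡0 0<x = ∣m-n∣≡0⇒m≡n ([ id , id ]′ (m*n≡0⇒m≡0∨n≡0 d d²≡0))
    where
    d²≡0 : d * d ≡ 0
    d²≡0 = trans (sym (*-identityˡ (d * d))) (trans (cong (_* (d * d)) (sym (𝟙-yes (0 <? x) 0<x))) term≡0)
  from : (0 < x → c * x ≡ a) → 𝟙 (0 <? x) * (d * d) ≡ 0
  from uniform = trans (𝟙-*-cong (0 <? x) (λ 0<x → cong (λ e → e * e) (m≡n⇒∣m-n∣≡0 (uniform 0<x))))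
                       (*-zeroʳ (𝟙 (0 <? x)))

defect≡0⇔ : ∀ c a (X : Fin n → ℕ) → defect c a X ≡ 0 ⇔ (∀ i → 0 < X i → c * X i ≡ a)
defect≡0⇔ c a X = pointwise ⇔-∘ sum≡0⇔ (λ i → defectTerm c a (X i))
  where
  pointwise : (∀ i → defectTerm c a (X i) ≡ 0) ⇔ (∀ i → 0 < X i → c * X i ≡ a)
  pointwise = mk⇔ (λ h i → Equivalence.to (defectTerm≡0⇔ c a (X i)) (h i))
                  (λ h i → Equivalence.from (defectTerm≡0⇔ c a (X i)) (h i))

module _ (c a : ℕ) .{{_ : NonZero a}} (X : Fin n → ℕ) where

  support-lower-bound : c * sumSq X ≤ a * sum X → c * sum X ≤ supportSize X * a
  support-lower-bound c∑X²≤a∑X =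
    *-cancelʳ-≤ (c * sum X) (supportSize X * a) a (+-cancelˡ-≤ (c * sum X * a) _ _ (begin
      c * sum X * a + c * sum X * a             ≡⟨ identity₁ c a (sum X) ⟩
      2 * (c * a) * sum X                       ≤⟨ m≤n+m _ (defect c a X) ⟩
      defect c a X + 2 * (c * a) * sum X        ≡⟨ defect-identity c a X ⟩
      c * c * sumSq X + supportSize X * (a * a) ≤⟨ +-monoˡ-≤ _ c²∑X²≤ca∑X ⟩
      c * (a * sum X) + supportSize X * (a * a) ≡⟨ identity₂ c a (sum X) (supportSize X) ⟩
      c * sum X * a + supportSize X * a * a     ∎))
    where
    open ≤-Reasoning
    c²∑X²≤ca∑X : c * c * sumSq X ≤ c * (a * sum X)
    c²∑X²≤ca∑X = ≤-trans (≤-reflexive (*-assoc c c (sumSq X))) (*-monoʳ-≤ c c∑X²≤a∑X)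
    identity₁ : ∀ c a s → c * s * a + c * s * a ≡ 2 * (c * a) * s
    identity₁ = solve-∀
    identity₂ : ∀ c a s m → c * (a * s) + m * (a * a) ≡ c * s * a + m * a * a
    identity₂ = solve-∀

  defect-balance : c * sumSq X ≡ a * sum X → defect c a X + c * sum X * a ≡ supportSize X * a * a
  defect-balance c∑X²≡a∑X = +-cancelʳ-≡ (c * sum X * a) _ _ (begin
    defect c a X + c * sum X * a + c * sum X * a ≡⟨ identity₁ (defect c a X) c a (sum X) ⟩
    defect c a X + 2 * (c * a) * sum X          ≡⟨ defect-identity c a X ⟩
    c * c * sumSq X + supportSize X * (a * a)   ≡⟨ cong (_+ supportSize X * (a * a)) (*-assoc c c (sumSq X)) ⟩
    c * (c * sumSq X) + supportSize X * (a * a) ≡⟨ cong (λ t → c * t + supportSize X * (a * a)) c∑X²≡a∑X ⟩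
    c * (a * sum X) + supportSize X * (a * a)   ≡⟨ identity₂ c a (sum X) (supportSize X) ⟩
    supportSize X * a * a + c * sum X * a       ∎)
    where
    open ≡-Reasoning
    identity₁ : ∀ e c a s → e + c * s * a + c * s * a ≡ e + 2 * (c * a) * s
    identity₁ = solve-∀
    identity₂ : ∀ c a s m → c * (a * s) + m * (a * a) ≡ m * a * a + c * s * a
    identity₂ = solve-∀

  support-tight : c * sumSq X ≡ a * sum X → (c * sum X ≡ supportSize X * a) ⇔ (defect c a X ≡ 0)
  support-tight c∑X²≡a∑X = mk⇔ to from
    where
    balance : defect c a X + c * sum X * a ≡ supportSize X * a * a
    balance = defect-balance c∑X²≡a∑X
    to : c * sum X ≡ supportSize X * a → defect c a X ≡ 0
    to c∑X≡ma = +-cancelʳ-≡ (supportSize X * a * a) (defect c a X) 0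
                  (trans (cong (λ t → defect c a X + t * a) (sym c∑X≡ma)) balance)
    from : defect c a X ≡ 0 → c * sum X ≡ supportSize X * a
    from defect≡0 = *-cancelʳ-≡ (c * sum X) (supportSize X * a) a
                      (trans (cong (_+ c * sum X * a) (sym defect≡0)) balance)

module _ {v b : ℕ} (B : Blocks v b) where

  replication≡∑χ : ∀ x → replication B x ≡ ∑[ i < b ] χ (B i) x
  replication≡∑χ x = length-filter-tabulate (λ i → x ∈? B i) id

  pairCount≡∑χχ : ∀ x y → pairCount B x y ≡ ∑[ i < b ] (χ (B i) x * χ (B i) y)
  pairCount≡∑χχ x y = trans (length-filter-tabulate (λ i → (x ∈? B i) ×-dec (y ∈? B i)) id)
                            (sum-cong-≗ λ i → 𝟙-×-dec (x ∈? B i) (y ∈? B i))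

  pairCount-diagonal : ∀ x → pairCount B x x ≡ replication B x
  pairCount-diagonal x = begin
    pairCount B x x                       ≡⟨ pairCount≡∑χχ x x ⟩
    ∑[ i < b ] (χ (B i) x * χ (B i) x)    ≡⟨ sum-cong-≗ (λ i → 𝟙-idem (x ∈? B i)) ⟩
    ∑[ i < b ] χ (B i) x                  ≡⟨ replication≡∑χ x ⟨
    replication B x                       ∎
    where open ≡-Reasoning

  pairCount≤replication : ∀ x y → pairCount B x y ≤ replication B x
  pairCount≤replication x y = begin
    pairCount B x y                       ≡⟨ pairCount≡∑χχ x y ⟩
    ∑[ i < b ] (χ (B i) x * χ (B i) y)
      ≤⟨ sum-mono-≤ (λ i → *-monoʳ-≤ (χ (B i) x) (𝟙≤1 (y ∈? B i))) ⟩
    ∑[ i < b ] (χ (B i) x * 1)            ≡⟨ sum-cong-≗ (λ i → *-identityʳ (χ (B i) x)) ⟩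
    ∑[ i < b ] χ (B i) x                  ≡⟨ replication≡∑χ x ⟨
    replication B x                       ∎
    where open ≤-Reasoning

  meetCount≡supportSize : ∀ S → meetCount B S ≡ supportSize (λ i → ∣ B i ∩ S ∣)
  meetCount≡supportSize S = trans (length-filter-tabulate (λ i → nonempty? (B i ∩ S)) id)
    (sum-cong-≗ λ i → 𝟙-cong (Nonempty⇔0<∣p∣ (B i ∩ S)) (nonempty? (B i ∩ S)) (0 <? ∣ B i ∩ S ∣))

  ∑∣B∩S∣≡∑replication : ∀ S → ∑[ i < b ] ∣ B i ∩ S ∣ ≡ ∑[ x < v ] (replication B x * χ S x)
  ∑∣B∩S∣≡∑replication S = begin
    ∑[ i < b ] ∣ B i ∩ S ∣                         ≡⟨ sum-cong-≗ (λ i → ∣p∩q∣≡∑χχ (B i) S) ⟩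
    ∑[ i < b ] ∑[ x < v ] (χ (B i) x * χ S x)      ≡⟨ ∑-comm (λ i x → χ (B i) x * χ S x) ⟩
    ∑[ x < v ] ∑[ i < b ] (χ (B i) x * χ S x)
      ≡⟨ sum-cong-≗ (λ x → *-distribʳ-sum (χ S x) (λ i → χ (B i) x)) ⟨
    ∑[ x < v ] (∑[ i < b ] χ (B i) x * χ S x)
      ≡⟨ sum-cong-≗ (λ x → cong (_* χ S x) (replication≡∑χ x)) ⟨
    ∑[ x < v ] (replication B x * χ S x)           ∎
    where open ≡-Reasoning

  sumSq∣B∩S∣≡∑pairCount : ∀ S →
    sumSq (λ i → ∣ B i ∩ S ∣) ≡ ∑[ x < v ] (χ S x * ∑[ y < v ] (χ S y * pairCount B x y))
  sumSq∣B∩S∣≡∑pairCount S = begin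
    ∑[ i < b ] (∣ B i ∩ S ∣ * ∣ B i ∩ S ∣)
      ≡⟨ sum-cong-≗ square≡∑∑term ⟩
    ∑[ i < b ] ∑[ x < v ] ∑[ y < v ] (term i x y)
      ≡⟨ ∑-comm (λ i x → ∑[ y < v ] term i x y) ⟩
    ∑[ x < v ] ∑[ i < b ] ∑[ y < v ] (term i x y)
      ≡⟨ sum-cong-≗ (λ x → ∑-comm (λ i y → term i x y)) ⟩
    ∑[ x < v ] ∑[ y < v ] ∑[ i < b ] (term i x y)
      ≡⟨ sum-cong-≗ (λ x → sum-cong-≗ (λ y → ∑term≡ x y)) ⟩
    ∑[ x < v ] ∑[ y < v ] (χ S x * (χ S y * pairCount B x y))
      ≡⟨ sum-cong-≗ (λ x → *-distribˡ-sum (χ S x) (λ y → χ S y * pairCount B x y)) ⟨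
    ∑[ x < v ] (χ S x * ∑[ y < v ] (χ S y * pairCount B x y)) ∎
    where
    open ≡-Reasoning
    term : Fin b → Fin v → Fin v → ℕ
    term i x y = χ (B i) x * χ S x * (χ (B i) y * χ S y)
    square≡∑∑term : ∀ i → ∣ B i ∩ S ∣ * ∣ B i ∩ S ∣ ≡ ∑[ x < v ] ∑[ y < v ] term i x y
    square≡∑∑term i = trans (cong₂ _*_ (∣p∩q∣≡∑χχ (B i) S) (∣p∩q∣≡∑χχ (B i) S))
                            (sum-*-sum (λ x → χ (B i) x * χ S x) (λ y → χ (B i) y * χ S y))
    rearrange : ∀ bx sx by sy → bx * sx * (by * sy) ≡ sx * sy * (bx * by)
    rearrange = solve-∀
    ∑term≡ : ∀ x y → ∑[ i < b ] term i x y ≡ χ S x * (χ S y * pairCount B x y)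
    ∑term≡ x y = begin
      ∑[ i < b ] term i x y
        ≡⟨ sum-cong-≗ (λ i → rearrange (χ (B i) x) (χ S x) (χ (B i) y) (χ S y)) ⟩
      ∑[ i < b ] (χ S x * χ S y * (χ (B i) x * χ (B i) y))
        ≡⟨ *-distribˡ-sum (χ S x * χ S y) (λ i → χ (B i) x * χ (B i) y) ⟨
      χ S x * χ S y * ∑[ i < b ] (χ (B i) x * χ (B i) y)
        ≡⟨ cong (χ S x * χ S y *_) (pairCount≡∑χχ x y) ⟨
      χ S x * χ S y * pairCount B x y
        ≡⟨ *-assoc (χ S x) (χ S y) (pairCount B x y) ⟩
      χ S x * (χ S y * pairCount B x y)
        ∎

module _ {v b k r lam : ℕ} {B : Blocks v b} (D : IsOfType B k r lam) where
  open IsOfType D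

  lam≤r : lam ≤ r
  lam≤r with x , y , _ , pairCount≡lam ← lam-attained = begin
    lam             ≡⟨ pairCount≡lam ⟨
    pairCount B x y ≤⟨ pairCount≤replication B x y ⟩
    replication B x ≡⟨ pointRepl x ⟩
    r               ∎
    where open ≤-Reasoning

  instance
    r-nonZero : NonZero r
    r-nonZero = >-nonZero (≤-trans lam-pos lam≤r)

  ∑∣B∩S∣≡r*∣S∣ : ∀ S → ∑[ i < b ] ∣ B i ∩ S ∣ ≡ r * ∣ S ∣
  ∑∣B∩S∣≡r*∣S∣ S = begin
    ∑[ i < b ] ∣ B i ∩ S ∣               ≡⟨ ∑∣B∩S∣≡∑replication B S ⟩
    ∑[ x < v ] (replication B x * χ S x) ≡⟨ sum-cong-≗ (λ x → cong (_* χ S x) (pointRepl x)) ⟩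
    ∑[ x < v ] (r * χ S x)               ≡⟨ *-distribˡ-sum r (χ S) ⟨
    r * sum (χ S)                        ≡⟨ cong (r *_) (∣p∣≡∑χ S) ⟨
    r * ∣ S ∣                            ∎
    where open ≡-Reasoning

  rowSum-≤ : ∀ S x → x ∈ S → ∑[ y < v ] (χ S y * pairCount B x y) ≤ r + (∣ S ∣ ∸ 1) * lam
  rowSum-≤ S x x∈S =
    subst (λ s → ∑[ y < v ] (χ S y * pairCount B x y) ≤ r + (s ∸ 1) * lam) (sym (∣p∣≡∑χ S))
    (sum-diagonal-≤ (χ S) (pairCount B x) (𝟙-yes (x ∈? S) x∈S)
      (trans (pairCount-diagonal B x) (pointRepl x)) (λ y y≢x → lam-bound x y (y≢x ∘ sym)))

  rowSum-≡ : IsDesign B lam → ∀ S x → x ∈ S →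
             ∑[ y < v ] (χ S y * pairCount B x y) ≡ r + (∣ S ∣ ∸ 1) * lam
  rowSum-≡ design S x x∈S =
    subst (λ s → ∑[ y < v ] (χ S y * pairCount B x y) ≡ r + (s ∸ 1) * lam) (sym (∣p∣≡∑χ S))
    (sum-diagonal-≡ (χ S) (pairCount B x) (𝟙-yes (x ∈? S) x∈S)
      (trans (pairCount-diagonal B x) (pointRepl x)) (λ y y≢x → design x y (y≢x ∘ sym)))

  sumSq∣B∩S∣-≤ : ∀ S → sumSq (λ i → ∣ B i ∩ S ∣) ≤ ∣ S ∣ * (r + (∣ S ∣ ∸ 1) * lam)
  sumSq∣B∩S∣-≤ S = begin
    sumSq (λ i → ∣ B i ∩ S ∣)                                 ≡⟨ sumSq∣B∩S∣≡∑pairCount B S ⟩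
    ∑[ x < v ] (χ S x * ∑[ y < v ] (χ S y * pairCount B x y))
      ≤⟨ sum-mono-≤ (λ x → 𝟙-*-mono-≤ (x ∈? S) (rowSum-≤ S x)) ⟩
    ∑[ x < v ] (χ S x * a)                                    ≡⟨ *-distribʳ-sum a (χ S) ⟨
    sum (χ S) * a                                             ≡⟨ cong (_* a) (∣p∣≡∑χ S) ⟨
    ∣ S ∣ * a                                                 ∎
    where
    open ≤-Reasoning
    a : ℕ
    a = r + (∣ S ∣ ∸ 1) * lam

  sumSq∣B∩S∣-≡ : IsDesign B lam → ∀ S →
                 sumSq (λ i → ∣ B i ∩ S ∣) ≡ ∣ S ∣ * (r + (∣ S ∣ ∸ 1) * lam)
  sumSq∣B∩S∣-≡ design S = begin
    sumSq (λ i → ∣ B i ∩ S ∣)                                 ≡⟨ sumSq∣B∩S∣≡∑pairCount B S ⟩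
    ∑[ x < v ] (χ S x * ∑[ y < v ] (χ S y * pairCount B x y))
      ≡⟨ sum-cong-≗ (λ x → 𝟙-*-cong (x ∈? S) (rowSum-≡ design S x)) ⟩
    ∑[ x < v ] (χ S x * a)                                    ≡⟨ *-distribʳ-sum a (χ S) ⟨
    sum (χ S) * a                                             ≡⟨ cong (_* a) (∣p∣≡∑χ S) ⟨
    ∣ S ∣ * a                                                 ∎
    where
    open ≡-Reasoning
    a : ℕ
    a = r + (∣ S ∣ ∸ 1) * lam

  module _ (S : Subset v) where
    private
      a : ℕ
      a = r + (∣ S ∣ ∸ 1) * lam
      X : Fin b → ℕ
      X i = ∣ B i ∩ S ∣
      instance
        a-nonZero : NonZero a
        a-nonZero = >-nonZero (≤-trans (>-nonZero⁻¹ r) (m≤m+n r _))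

    r∑X≡r²∣S∣ : r * sum X ≡ r * r * ∣ S ∣
    r∑X≡r²∣S∣ = trans (cong (r *_) (∑∣B∩S∣≡r*∣S∣ S)) (sym (*-assoc r r ∣ S ∣))

    r∣S∣a≡a∑X : r * (∣ S ∣ * a) ≡ a * sum X
    r∣S∣a≡a∑X = begin
      r * (∣ S ∣ * a) ≡⟨ identity r ∣ S ∣ a ⟩
      a * (r * ∣ S ∣) ≡⟨ cong (a *_) (∑∣B∩S∣≡r*∣S∣ S) ⟨
      a * sum X       ∎
      where
      open ≡-Reasoning
      identity : ∀ r s a → r * (s * a) ≡ a * (r * s)
      identity = solve-∀

    meetCount*a≡supportSize*a : meetCount B S * a ≡ supportSize X * a
    meetCount*a≡supportSize*a = cong (_* a) (meetCount≡supportSize B S)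

    meetCount-lower-bound : r * r * ∣ S ∣ ≤ meetCount B S * a
    meetCount-lower-bound = subst₂ _≤_ r∑X≡r²∣S∣ (sym meetCount*a≡supportSize*a)
      (support-lower-bound r a X (≤-trans (*-monoʳ-≤ r (sumSq∣B∩S∣-≤ S)) (≤-reflexive r∣S∣a≡a∑X)))

    meetCount-tight : IsDesign B lam → (meetCount B S * a ≡ r * r * ∣ S ∣) ⇔ (∀ i → 0 < X i → r * X i ≡ a)
    meetCount-tight design = defect≡0⇔ r a X ⇔-∘ (support-tight r a X r∑X²≡a∑X ⇔-∘ reorient)
      where
      r∑X²≡a∑X : r * sumSq X ≡ a * sum X
      r∑X²≡a∑X = trans (cong (r *_) (sumSq∣B∩S∣-≡ design S)) r∣S∣a≡a∑X
      reorient : (meetCount B S * a ≡ r * r * ∣ S ∣) ⇔ (r * sum X ≡ supportSize X * a)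
      reorient = mk⇔ (λ eq → trans r∑X≡r²∣S∣ (trans (sym eq) meetCount*a≡supportSize*a))
                     (λ eq → trans meetCount*a≡supportSize*a (trans (sym eq) r∑X≡r²∣S∣))

    uniform⇔maximalArc : Nonempty S →
      (∀ i → 0 < X i → r * X i ≡ a) ⇔ Σ ℕ (λ n → (n * r ≡ a) × IsMaximalArc B S n)
    uniform⇔maximalArc S≢∅ = mk⇔ to from
      where
      some-block-meets-S : ∃ λ i → X i ≢ 0
      some-block-meets-S = sum≢0⇒∃≢0 X (subst (_≢ 0) (sym (∑∣B∩S∣≡r*∣S∣ S)) r∣S∣≢0)
        where
        r∣S∣≢0 : r * ∣ S ∣ ≢ 0
        r∣S∣≢0 = [ ≢-nonZero⁻¹ r , n>0⇒n≢0 (Equivalence.to (Nonempty⇔0<∣p∣ S) S≢∅) ]′ ∘ m*n≡0⇒m≡0∨n≡0 r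
      to : (∀ i → 0 < X i → r * X i ≡ a) → Σ ℕ (λ n → (n * r ≡ a) × IsMaximalArc B S n)
      to uniform with i₀ , Xi₀≢0 ← some-block-meets-S =
        X i₀ , trans (*-comm (X i₀) r) (uniform i₀ (n≢0⇒n>0 Xi₀≢0)) , S≢∅ , arc
        where
        arc : ∀ i → (X i ≡ 0) ⊎ (X i ≡ X i₀)
        arc i with X i ≟ 0
        ... | yes Xi≡0 = inj₁ Xi≡0
        ... | no  Xi≢0 = inj₂ (*-cancelˡ-≡ (X i) (X i₀) r
                                 (trans (uniform i (n≢0⇒n>0 Xi≢0)) (sym (uniform i₀ (n≢0⇒n>0 Xi₀≢0)))))
      from : Σ ℕ (λ n → (n * r ≡ a) × IsMaximalArc B S n) → ∀ i → 0 < X i → r * X i ≡ a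
      from (n , nr≡a , _ , arc) i 0<Xi with arc i
      ... | inj₁ Xi≡0 = contradiction Xi≡0 (n>0⇒n≢0 0<Xi)
      ... | inj₂ Xi≡n = trans (cong (r *_) Xi≡n) (trans (*-comm r n) nr≡a)

lemma3p2 : ∀ {v b k r lam : ℕ} (B : Blocks v b) → IsOfType B k r lam →
    (S : Subset v) → Nonempty S →
      (r * r * ∣ S ∣ ≤ meetCount B S * (r + (∣ S ∣ ∸ 1) * lam))
      × (IsDesign B lam →
          ((meetCount B S * (r + (∣ S ∣ ∸ 1) * lam) ≡ r * r * ∣ S ∣)
            ⇔ Σ ℕ (λ n → (n * r ≡ r + (∣ S ∣ ∸ 1) * lam) × IsMaximalArc B S n)))
lemma3p2 B D S S≢∅ =
  meetCount-lower-bound D S , λ design → uniform⇔maximalArc D S S≢∅ ⇔-∘ meetCount-tight D S design
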